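{- Let $G=(X,Y,E)$ be a bipartite graph, let $d=\max_{y\in Y}\deg(y)$ (so $d\le |X|$), and let $k$ be the minimum cardinality of a set $D\subseteq X$ that dominates $Y$ (i.e. every $y\in Y$ has a neighbour in $D$). Then the number of subsets $D\subseteq X$ of cardinality $k$ dominating $Y$ (minimum cardinality red dominating sets) is $\mathcal O(d^k)$.
   Context: Graphs are finite, simple, undirected and connected. A red dominating set of a bipartite graph $G=(X,Y,E)$ is a set $D\subseteq X$ such that every $y\in Y$ is adjacent to some vertex of $D$; an MCRD set is a red dominating set of minimum cardinality. -}

module Defs where

open import Data.Bool using (Bool; true; false)
open import Data.Nat using (ℕ; zero; suc; _≤_; _⊔_)
open import Data.Fin using (Fin)
open import Data.Fin.Subset using (Subset; _∈_; ∣_∣; inside; outside)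
open import Data.Fin.Subset.Properties using (_∈?_)
open import Data.Fin.Properties using (all?; any?)
open import Data.Sum using (_⊎_; inj₁; inj₂)
open import Data.Product using (Σ; _×_; _,_; ∃)
open import Data.List using (List; []; _∷_; _++_; map; filter; length; foldr; allFin)
open import Data.Vec using ([]; _∷_; tabulate)
open import Relation.Nullary using (Dec)
open import Relation.Nullary.Decidable using (_×-dec_)
open import Relation.Binary.PropositionalEquality using (_≡_)
open import Data.Nat.Properties using (_≟_)
import Data.Bool.Properties as BoolP

-- A finite simple bipartite graph G = (X, Y, E) with X = Fin m, Y = Fin n,
-- given by its bipartite adjacency relation: E x y ≡ true iff xy is an edge.
BipGraph : ℕ → ℕ → Set
BipGraph m n = Fin m → Fin n → Bool

Vertex : ℕ → ℕ → Set
Vertex m n = Fin m ⊎ Fin n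

data Adj {m n : ℕ} (E : BipGraph m n) : Vertex m n → Vertex m n → Set where
  xy : ∀ {x y} → E x y ≡ true → Adj E (inj₁ x) (inj₂ y)
  yx : ∀ {x y} → E x y ≡ true → Adj E (inj₂ y) (inj₁ x)

data Reach {m n : ℕ} (E : BipGraph m n) : Vertex m n → Vertex m n → Set where
  here : ∀ {u} → Reach E u u
  step : ∀ {u v w} → Adj E u v → Reach E v w → Reach E u w

Connected : ∀ {m n} → BipGraph m n → Set
Connected E = ∀ u v → Reach E u v

RedDominating : ∀ {m n} → BipGraph m n → Subset m → Set
RedDominating E D = ∀ y → ∃ λ x → x ∈ D × E x y ≡ true

redDominating? : ∀ {m n} (E : BipGraph m n) (D : Subset m) → Dec (RedDominating E D)
redDominating? E D = all? (λ y → any? (λ x → (x ∈? D) ×-dec (E x y BoolP.≟ true)))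

IsRedDominationNumber : ∀ {m n} → BipGraph m n → ℕ → Set
IsRedDominationNumber E k =
  (Σ _ λ D → RedDominating E D × ∣ D ∣ ≡ k) × (∀ D → RedDominating E D → k ≤ ∣ D ∣)

MCRD : ∀ {m n} → BipGraph m n → ℕ → Subset m → Set
MCRD E k D = RedDominating E D × ∣ D ∣ ≡ k

MCRD? : ∀ {m n} (E : BipGraph m n) (k : ℕ) (D : Subset m) → Dec (MCRD E k D)
MCRD? E k D = redDominating? E D ×-dec (∣ D ∣ ≟ k)

allSubsets : ∀ m → List (Subset m)
allSubsets zero = [] ∷ []
allSubsets (suc m) = map (outside ∷_) (allSubsets m) ++ map (inside ∷_) (allSubsets m)

numMCRD : ∀ {m n} → BipGraph m n → ℕ → ℕ
numMCRD {m} E k = length (filter (MCRD? E k) (allSubsets m))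

degY : ∀ {m n} → BipGraph m n → Fin n → ℕ
degY E y = ∣ tabulate (λ x → E x y) ∣

-- d = max_{y ∈ Y} deg(y)  (0 if Y is empty).
maxDegY : ∀ {m n} → BipGraph m n → ℕ
maxDegY {n = n} E = foldr _⊔_ 0 (map (degY E) (allFin n))

{-# OPTIONS --safe #-}
-- Branching: starting from S = ∅, as long as some y ∈ Y is undominated, pick the
-- first such y and branch on which of its at most d neighbours to add to S.
-- A minimum red dominating set D is reached along one branch of depth k: the
-- chosen y has a neighbour in D, and adding it keeps S ⊆ D; once S dominates Y,
-- minimality of D forces S = D. Hence every MCRD set is the image of a word of
-- length k over {0, …, d - 1}, and there are at most d ^ k of them.
module Submission where

open import Defs
open import Data.Nat using (ℕ; _≤_; _*_; _^_)
open import Data.Product using (Σ)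

open import Data.Nat using (zero; suc; _+_; _<_; _⊔_; z≤n; s≤s)
open import Data.Nat.Properties
  using (≤-reflexive; <-≤-trans; <⇒≱; m≤m⊔n; m≤n⇒m≤o⊔n; +-suc; +-identityʳ; +-cancelˡ-≡; *-identityˡ)
  renaming (module ≤-Reasoning to ℕ≤-Reasoning)
open import Data.Bool using (true)
open import Data.Fin using (Fin; zero; suc)
open import Data.Fin.Subset using (Subset; inside; outside; ∣_∣; _⊆_; _∪_; ⁅_⁆; ⊥)
  renaming (_∈_ to _∈ₛ_; _∉_ to _∉ₛ_)
open import Data.Fin.Subset.Properties
  using (_∈?_; ⊆-antisym; ⊆-min; ∣⊥∣≡0; p⊂q⇒∣p∣<∣q∣; ∪-identityʳ; x∈p∪q⁻; x∈⁅y⁆⇒x≡y)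
open import Data.Fin.Properties using (any?)
open import Data.Vec using ([]; _∷_; tabulate; here; there)
open import Data.Vec.Properties using (lookup⇒[]=; lookup∘tabulate)
open import Data.List
  using (List; []; _∷_; [_]; _++_; map; filter; length; foldr; allFin; upTo; head; drop; cartesianProductWith)
open import Data.List.Properties using (length-++; length-map; length-removeAt′; length-upTo)
open import Data.List.Relation.Unary.Any using (here; there; index)
import Data.List.Relation.Unary.All as All
open import Data.List.Relation.Unary.AllPairs using ([]; _∷_)
open import Data.List.Relation.Unary.Unique.Propositional using (Unique)
import Data.List.Relation.Unary.Unique.Propositional.Properties as Unique
open import Data.List.Relation.Binary.Subset.Propositional using () renaming (_⊆_ to _⊆ₗ_)
open import Data.List.Membership.Propositional using (_∈_; _─_)
open import Data.List.Membership.Propositional.Properties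
  using (∈-map⁺; ∈-map⁻; ∈-filter⁻; ∈-allFin; ∈-upTo⁺; ∈-cartesianProductWith⁺)
open import Data.Product using (_×_; _,_; ∃; proj₂)
open import Data.Sum using (inj₁; inj₂)
open import Data.Maybe using (just; maybe′)
open import Function using (_∘_)
open import Relation.Nullary using (Dec; yes; no; ¬_; ¬?; contradiction)
open import Relation.Nullary.Decidable using (_×-dec_; decidable-stable)
open import Relation.Binary.PropositionalEquality
  using (_≡_; _≢_; refl; sym; trans; cong; cong₂; subst; module ≡-Reasoning)
import Data.Bool.Properties as Bool

module _ {a} {A : Set a} where

  ∈-─⁺ : ∀ {x z : A} {ys} (x∈ys : x ∈ ys) → z ∈ ys → z ≢ x → z ∈ ys ─ x∈ys
  ∈-─⁺ (here refl)   (here z≡x)   z≢x = contradiction z≡x z≢x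
  ∈-─⁺ (here refl)   (there z∈ys) _   = z∈ys
  ∈-─⁺ (there _)     (here z≡y)   _   = here z≡y
  ∈-─⁺ (there x∈ys)  (there z∈ys) z≢x = there (∈-─⁺ x∈ys z∈ys z≢x)

  Unique∧⊆⇒length≤ : ∀ {xs ys : List A} → Unique xs → xs ⊆ₗ ys → length xs ≤ length ys
  Unique∧⊆⇒length≤ {[]}           _                  _     = z≤n
  Unique∧⊆⇒length≤ {x ∷ xs} {ys} (x∉xs ∷ unique-xs) xs⊆ys = begin
    suc (length xs)           ≤⟨ s≤s (Unique∧⊆⇒length≤ unique-xs xs⊆ys─x) ⟩
    suc (length (ys ─ x∈ys))  ≡⟨ length-removeAt′ ys (index x∈ys) ⟨
    length ys                 ∎
    where
    open ℕ≤-Reasoning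
    x∈ys : x ∈ ys
    x∈ys = xs⊆ys (here refl)
    xs⊆ys─x : xs ⊆ₗ ys ─ x∈ys
    xs⊆ys─x z∈xs = ∈-─⁺ x∈ys (xs⊆ys (there z∈xs)) (λ z≡x → All.lookup x∉xs z∈xs (sym z≡x))

  ∈⇒head∘drop : ∀ {x : A} {xs} → x ∈ xs → ∃ λ i → i < length xs × head (drop i xs) ≡ just x
  ∈⇒head∘drop (here refl) = zero , s≤s z≤n , refl
  ∈⇒head∘drop (there x∈xs) with i , i<len , eq ← ∈⇒head∘drop x∈xs = suc i , s≤s i<len , eq

length-cartesianProductWith : ∀ {a b c} {A : Set a} {B : Set b} {C : Set c} (f : A → B → C) xs ys →
                              length (cartesianProductWith f xs ys) ≡ length xs * length ys
length-cartesianProductWith f []       ys = refl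
length-cartesianProductWith f (x ∷ xs) ys = begin
  length (map (f x) ys ++ cartesianProductWith f xs ys)            ≡⟨ length-++ (map (f x) ys) ⟩
  length (map (f x) ys) + length (cartesianProductWith f xs ys)   ≡⟨ cong₂ _+_ (length-map (f x) ys)
                                                                            (length-cartesianProductWith f xs ys) ⟩
  length ys + length xs * length ys                                ∎
  where open ≡-Reasoning

≤-foldr-⊔ : ∀ {n} xs → n ∈ xs → n ≤ foldr _⊔_ 0 xs
≤-foldr-⊔ (x ∷ xs) (here refl)  = m≤m⊔n x (foldr _⊔_ 0 xs)
≤-foldr-⊔ (x ∷ xs) (there n∈xs) = m≤n⇒m≤o⊔n x (≤-foldr-⊔ xs n∈xs)

words : ℕ → ℕ → List (List ℕ)
words d zero    = [ [] ]
words d (suc j) = cartesianProductWith _∷_ (upTo d) (words d j)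

length-words : ∀ d j → length (words d j) ≡ d ^ j
length-words d zero    = refl
length-words d (suc j) = begin
  length (cartesianProductWith _∷_ (upTo d) (words d j)) ≡⟨ length-cartesianProductWith _∷_ (upTo d) (words d j) ⟩
  length (upTo d) * length (words d j)                   ≡⟨ cong₂ _*_ (length-upTo d) (length-words d j) ⟩
  d * d ^ j                                              ∎
  where open ≡-Reasoning

Unique-allSubsets : ∀ m → Unique (allSubsets m)
Unique-allSubsets zero    = All.[] ∷ []
Unique-allSubsets (suc m) =
  Unique.++⁺ (Unique.map⁺ ∷-injectiveʳ (Unique-allSubsets m))
             (Unique.map⁺ ∷-injectiveʳ (Unique-allSubsets m))
             disjoint
  where
  ∷-injectiveʳ : ∀ {b} {p q : Subset m} → _≡_ {A = Subset (suc m)} (b ∷ p) (b ∷ q) → p ≡ q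
  ∷-injectiveʳ refl = refl
  disjoint : ∀ {p} → ¬ (p ∈ map (outside ∷_) (allSubsets m) × p ∈ map (inside ∷_) (allSubsets m))
  disjoint (p∈out , p∈in) with ∈-map⁻ (outside ∷_) p∈out | ∈-map⁻ (inside ∷_) p∈in
  ... | _ , _ , refl | _ , _ , ()

members : ∀ {m} → Subset m → List (Fin m)
members []            = []
members (inside ∷ p)  = zero ∷ map suc (members p)
members (outside ∷ p) = map suc (members p)

length-members : ∀ {m} (p : Subset m) → length (members p) ≡ ∣ p ∣
length-members []            = refl
length-members (inside ∷ p)  = cong suc (trans (length-map suc (members p)) (length-members p))
length-members (outside ∷ p) = trans (length-map suc (members p)) (length-members p)

∈-members⁺ : ∀ {m} {p : Subset m} {x} → x ∈ₛ p → x ∈ members p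
∈-members⁺ here                          = here refl
∈-members⁺ {p = inside ∷ _}  (there x∈p) = there (∈-map⁺ suc (∈-members⁺ x∈p))
∈-members⁺ {p = outside ∷ _} (there x∈p) = ∈-map⁺ suc (∈-members⁺ x∈p)

x∉p⇒∣p∪⁅x⁆∣≡1+∣p∣ : ∀ {m} (p : Subset m) x → x ∉ₛ p → ∣ p ∪ ⁅ x ⁆ ∣ ≡ suc ∣ p ∣
x∉p⇒∣p∪⁅x⁆∣≡1+∣p∣ (inside ∷ p)  zero    x∉p = contradiction here x∉p
x∉p⇒∣p∪⁅x⁆∣≡1+∣p∣ (outside ∷ p) zero    _   = cong (λ q → suc ∣ q ∣) (∪-identityʳ p)
x∉p⇒∣p∪⁅x⁆∣≡1+∣p∣ (inside ∷ p)  (suc x) x∉p = cong suc (x∉p⇒∣p∪⁅x⁆∣≡1+∣p∣ p x (x∉p ∘ there))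
x∉p⇒∣p∪⁅x⁆∣≡1+∣p∣ (outside ∷ p) (suc x) x∉p = x∉p⇒∣p∪⁅x⁆∣≡1+∣p∣ p x (x∉p ∘ there)

p⊆r∧x∈r⇒p∪⁅x⁆⊆r : ∀ {m} {p r : Subset m} {x} → p ⊆ r → x ∈ₛ r → p ∪ ⁅ x ⁆ ⊆ r
p⊆r∧x∈r⇒p∪⁅x⁆⊆r {p = p} {x = x} p⊆r x∈r y∈p∪x with x∈p∪q⁻ p ⁅ x ⁆ y∈p∪x
... | inj₁ y∈p  = p⊆r y∈p
... | inj₂ y∈⁅x⁆ = subst (_∈ₛ _) (sym (x∈⁅y⁆⇒x≡y x y∈⁅x⁆)) x∈r

p⊆q∧∣q∣≤∣p∣⇒p≡q : ∀ {m} {p q : Subset m} → p ⊆ q → ∣ q ∣ ≤ ∣ p ∣ → p ≡ q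
p⊆q∧∣q∣≤∣p∣⇒p≡q {p = p} {q} p⊆q ∣q∣≤∣p∣ = ⊆-antisym p⊆q q⊆p
  where
  q⊆p : q ⊆ p
  q⊆p {x} x∈q with x ∈? p
  ... | yes x∈p = x∈p
  ... | no  x∉p = contradiction ∣q∣≤∣p∣ (<⇒≱ (p⊂q⇒∣p∣<∣q∣ (p⊆q , x , x∈q , x∉p)))

module Branching {m n : ℕ} (E : BipGraph m n) where

  Dominated : Subset m → Fin n → Set
  Dominated S y = ∃ λ x → x ∈ₛ S × E x y ≡ true

  dominated? : ∀ S y → Dec (Dominated S y)
  dominated? S y = any? (λ x → (x ∈? S) ×-dec (E x y Bool.≟ true))

  undominated? : ∀ S → Dec (∃ λ y → ¬ Dominated S y)
  undominated? S = any? (λ y → ¬? (dominated? S y))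

  neighbours : Fin n → List (Fin m)
  neighbours y = members (tabulate (λ x → E x y))

  length-neighbours≤maxDegY : ∀ y → length (neighbours y) ≤ maxDegY E
  length-neighbours≤maxDegY y =
    subst (_≤ maxDegY E) (sym (length-members (tabulate (λ x → E x y))))
      (≤-foldr-⊔ (map (degY E) (allFin n)) (∈-map⁺ (degY E) (∈-allFin y)))

  ∈-neighbours : ∀ {x y} → E x y ≡ true → x ∈ neighbours y
  ∈-neighbours {x} {y} x~y =
    ∈-members⁺ {p = tabulate (λ x → E x y)} (lookup⇒[]= x _ (trans (lookup∘tabulate (λ x → E x y) x) x~y))

  branch : ∀ S → Dec (∃ λ y → ¬ Dominated S y) → ℕ → Subset m
  branch S (no _)        i = S
  branch S (yes (y , _)) i = maybe′ (λ x → S ∪ ⁅ x ⁆) S (head (drop i (neighbours y)))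

  decode : Subset m → List ℕ → Subset m
  decode S []       = S
  decode S (i ∷ is) = decode (branch S (undominated? S) i) is

  branch-∪⁅⁆ : ∀ {S y i x} {y-undom : ¬ Dominated S y} → undominated? S ≡ yes (y , y-undom) →
               head (drop i (neighbours y)) ≡ just x → branch S (undominated? S) i ≡ S ∪ ⁅ x ⁆
  branch-∪⁅⁆ first-undom ith-neighbour rewrite first-undom | ith-neighbour = refl

  module _ {D : Subset m} (D-dom : RedDominating E D)
           (D-min : ∀ T → RedDominating E T → ∣ D ∣ ≤ ∣ T ∣) where

    decode-onto : ∀ j S → S ⊆ D → ∣ S ∣ + j ≡ ∣ D ∣ →
                  ∃ λ w → w ∈ words (maxDegY E) j × decode S w ≡ D
    decode-onto j S S⊆D size with undominated? S in first-undom
    ... | no no-undom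
      with refl ← p⊆q∧∣q∣≤∣p∣⇒p≡q S⊆D
                    (D-min S (λ y → decidable-stable (dominated? S y) (λ ¬y → no-undom (y , ¬y))))
      with refl ← +-cancelˡ-≡ ∣ D ∣ j 0 (trans size (sym (+-identityʳ ∣ D ∣)))
      = [] , here refl , refl
    ... | yes (y , y-undom) with x , x∈D , x~y ← D-dom y with j
    ...   | zero = contradiction (x , subst (x ∈ₛ_) (sym S≡D) x∈D , x~y) y-undom
      where
      S≡D : S ≡ D
      S≡D = p⊆q∧∣q∣≤∣p∣⇒p≡q S⊆D (≤-reflexive (trans (sym size) (+-identityʳ ∣ S ∣)))
    ...   | suc j
      with i , i<deg , ith-neighbour ← ∈⇒head∘drop (∈-neighbours x~y)
      with w , w∈words , decoded ← decode-onto j (S ∪ ⁅ x ⁆) (p⊆r∧x∈r⇒p∪⁅x⁆⊆r S⊆D x∈D)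
             (trans (cong (_+ j) (x∉p⇒∣p∪⁅x⁆∣≡1+∣p∣ S x (λ x∈S → y-undom (x , x∈S , x~y))))
                    (trans (sym (+-suc ∣ S ∣ j)) size))
      = i ∷ w
      , ∈-cartesianProductWith⁺ _∷_ (∈-upTo⁺ (<-≤-trans i<deg (length-neighbours≤maxDegY y))) w∈words
      , trans (cong (λ T → decode T w) (branch-∪⁅⁆ first-undom ith-neighbour)) decoded

  MCRD⊆decode : ∀ {k} → (∀ T → RedDominating E T → k ≤ ∣ T ∣) →
                filter (MCRD? E k) (allSubsets m) ⊆ₗ map (decode ⊥) (words (maxDegY E) k)
  MCRD⊆decode {k} k-min {D} D∈
    with D-dom , refl ← proj₂ (∈-filter⁻ (MCRD? E k) {xs = allSubsets m} D∈)
    with w , w∈words , decoded ← decode-onto D-dom k-min ∣ D ∣ ⊥ (⊆-min D) (cong (_+ ∣ D ∣) (∣⊥∣≡0 m))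
    = subst (_∈ _) decoded (∈-map⁺ (decode ⊥) w∈words)

  numMCRD≤maxDegY^k : ∀ {k} → (∀ T → RedDominating E T → k ≤ ∣ T ∣) → numMCRD E k ≤ maxDegY E ^ k
  numMCRD≤maxDegY^k {k} k-min = begin
    numMCRD E k                                    ≤⟨ Unique∧⊆⇒length≤ unique-MCRDs (MCRD⊆decode k-min) ⟩
    length (map (decode ⊥) (words (maxDegY E) k))  ≡⟨ length-map (decode ⊥) (words (maxDegY E) k) ⟩
    length (words (maxDegY E) k)                   ≡⟨ length-words (maxDegY E) k ⟩
    maxDegY E ^ k                                  ∎
    where
    open ℕ≤-Reasoning
    unique-MCRDs : Unique (filter (MCRD? E k) (allSubsets m))
    unique-MCRDs = Unique.filter⁺ (MCRD? E k) (Unique-allSubsets m)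

theorem2 : Σ ℕ λ C → ∀ m n (E : BipGraph m n) → Connected E → ∀ k →
             IsRedDominationNumber E k → numMCRD E k ≤ C * maxDegY E ^ k
theorem2 = 1 , λ m n E _ k (_ , k-min) →
  subst (numMCRD E k ≤_) (sym (*-identityˡ (maxDegY E ^ k))) (Branching.numMCRD≤maxDegY^k E k-min)
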